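{- There exists a plain interpretation for $\mathbf{P}[\bot]$, and there exists a plain interpretation for $\mathbf{P}[\bot_w]$. Here, for $\mathbf{L}\in\{\mathbf{P}[\bot],\mathbf{P}[\bot_w]\}$, an interpretation $I=\langle\mathcal A,v\rangle$ of $\mathbf{L}$ is plain if it is injective ($v(\varphi_1)=v(\varphi_2)$ implies $\varphi_1=\varphi_2$ for all infons) and conservative (for every set $T$ of infons deductively closed in $\mathbf{L}$, the least $\mathbf{L}$-closed set containing $v(T)$ contains no string $v(\psi)$ with $\psi\notin T$).
   Context: Infons: fix a set $At$ of atomic infons; infons are generated by $\varphi ::= \top\mid\bot \mid At \mid (\varphi\wedge\varphi)\mid(\varphi\to\varphi)$. Basic rules (of $\mathbf{P}$): from $\varphi_1,\varphi_2$ infer $\varphi_1\wedge\varphi_2$; from $\varphi_1\wedge\varphi_2$ infer $\varphi_i$ ($i=1,2$); from $\varphi_2$ infer $\varphi_1\to\varphi_2$; from $\varphi_1$ and $\varphi_1\to\varphi_2$ infer $\varphi_2$. $\mathbf{P}[\bot]$ adds the rule: from $\bot$ infer any $\varphi$. $\mathbf{P}[\bot_w]$ instead adds the rule: from $\bot$ and $\varphi\to\psi$ infer $\psi$. In logic $\mathbf{L}$, $\Gamma\vdash\varphi$ iff there is a finite sequence ending in $\varphi$ whose members are in $\Gamma\cup\{\top\}$ or follow from earlier members by the rules of $\mathbf{L}$. $T$ is deductively closed in $\mathbf{L}$ if $T\vdash\psi$ implies $\psi\in T$. Infon algebras for these logics: $\Sigma=\{0,1\}$, $\mathsf f\notin\Sigma$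 a new letter, $\Sigma_\bot=\Sigma\cup\{\mathsf f\}$. $\mathcal A=\langle\Sigma_\bot^*,\pi,l,r,\mathrm{enc},\mathrm{dec},E\rangle$ where $\pi,\mathrm{enc}:(\Sigma_\bot^*)^2\to\Sigma_\bot^*$ are total, $l,r,\mathrm{dec}$ are partial, $l(\pi(x,y))=x$, $r(\pi(x,y))=y$, $\mathrm{dec}(x,\mathrm{enc}(x,y))=y$ defined and valid for all $x,y\in\Sigma_\bot^*$, all these functions map arguments in $\Sigma^*$ to values in $\Sigma^*$ (when defined), and $\emptyset\ne E\subseteq\Sigma^*$. For $\mathbf{P}[\bot_w]$ the algebra additionally has a partial operation $\mathrm{crack}$ with $\mathrm{crack}(\mathsf f,\mathrm{enc}(a,b))=b$ for all $a,b$. An interpretation is $\langle\mathcal A,v\rangle$ with $v:At\cup\{\top,\bot\}\to\Sigma_\bot^*$, $v(\bot)=\mathsf f$, $v(\top)\in E$, $v(p)\in\Sigma^*$ for $p\in At$, extended by $v(\varphi_1\wedge\varphi_2)=\pi(v(\varphi_1),v(\varphi_2))$, $v(\varphi_1\to\varphi_2)=\mathrm{enc}(v(\varphi_1),v(\varphi_2))$. $M\subseteq\Sigma_\bot^*$ is $\mathbf{L}$-closed if $E\subseteq M$ and for all $a,b\in\Sigma_\bot^*$: (1) $a,b\in M\iff\pi(a,b)\in M$; (2) $a,\mathrm{enc}(a,b)\in M\Rightarrow b\in M$; (3) $b\in M\Rightarrow\mathrm{enc}(a,b)\in M$; and, for $\mathbf{L}=\mathbf{P}[\bot]$: (4) if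 $\mathsf f\in M$ then every $a\in\Sigma_\bot^*$ is in $M$; for $\mathbf{L}=\mathbf{P}[\bot_w]$: (4') $\mathsf f\in M$ and $\mathrm{enc}(a,b)\in M$ imply $b\in M$. -}

module Defs where

open import Data.Nat using (ℕ)
open import Data.List using (List; []; _∷_)
open import Data.List.Relation.Unary.All using (All)
open import Data.Maybe using (Maybe; just)
open import Data.Product using (Σ; ∃; _×_; _,_)
open import Data.Unit using (⊤)
open import Function.Bundles using (_⇔_)
open import Relation.Binary.PropositionalEquality using (_≡_; _≢_)
open import Relation.Nullary using (¬_)
open import Level using (Level; suc; zero)

data Infon (At : Set) : Set where
  top bot : Infon At
  atom    : At → Infon At
  _∧ᵢ_    : Infon At → Infon At → Infon At
  _⇒ᵢ_    : Infon At → Infon At → Infon At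

data Logic : Set where
  P⊥ P⊥w : Logic

-- Derivability  Γ ⊢ φ  in logic L (derivation trees; equivalent to the
-- finite-sequence definition). Sets of infons are predicates.
data _⊢[_]_ {At : Set} (Γ : Infon At → Set) : Logic → Infon At → Set where
  hyp   : ∀ {L φ} → Γ φ → Γ ⊢[ L ] φ
  topI  : ∀ {L} → Γ ⊢[ L ] top
  ∧I    : ∀ {L φ ψ} → Γ ⊢[ L ] φ → Γ ⊢[ L ] ψ → Γ ⊢[ L ] (φ ∧ᵢ ψ)
  ∧E₁   : ∀ {L φ ψ} → Γ ⊢[ L ] (φ ∧ᵢ ψ) → Γ ⊢[ L ] φ
  ∧E₂   : ∀ {L φ ψ} → Γ ⊢[ L ] (φ ∧ᵢ ψ) → Γ ⊢[ L ] ψ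
  ⇒I    : ∀ {L φ ψ} → Γ ⊢[ L ] ψ → Γ ⊢[ L ] (φ ⇒ᵢ ψ)
  ⇒E    : ∀ {L φ ψ} → Γ ⊢[ L ] φ → Γ ⊢[ L ] (φ ⇒ᵢ ψ) → Γ ⊢[ L ] ψ
  ⊥E    : ∀ {φ} → Γ ⊢[ P⊥ ] bot → Γ ⊢[ P⊥ ] φ
  ⊥wE   : ∀ {φ ψ} → Γ ⊢[ P⊥w ] bot → Γ ⊢[ P⊥w ] (φ ⇒ᵢ ψ) → Γ ⊢[ P⊥w ] ψ

DedClosed : {At : Set} → Logic → (Infon At → Set) → Set
DedClosed L T = ∀ ψ → T ⊢[ L ] ψ → T ψ

data Sym : Set where
  b0 b1 𝕗 : Sym

Str : Set
Str = List Sym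

InΣ* : Str → Set
InΣ* = All (λ s → s ≢ 𝕗)

fstr : Str
fstr = 𝕗 ∷ []

Extra : Logic → (Str → Str → Str) → Set
Extra P⊥  enc = ⊤
Extra P⊥w enc = Σ (Str → Str → Maybe Str) λ crack →
                  ∀ a b → crack fstr (enc a b) ≡ just b

record InfonAlgebra (L : Logic) : Set₁ where
  field
    π   : Str → Str → Str
    enc : Str → Str → Str
    l r : Str → Maybe Str
    dec : Str → Str → Maybe Str
    E   : Str → Set
    l-π     : ∀ x y → l (π x y) ≡ just x
    r-π     : ∀ x y → r (π x y) ≡ just y
    dec-enc : ∀ x y → dec x (enc x y) ≡ just y
    π-Σ*    : ∀ x y → InΣ* x → InΣ* y → InΣ* (π x y)
    enc-Σ*  : ∀ x y → InΣ* x → InΣ* y → InΣ* (enc x y)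
    l-Σ*    : ∀ x z → InΣ* x → l x ≡ just z → InΣ* z
    r-Σ*    : ∀ x z → InΣ* x → r x ≡ just z → InΣ* z
    dec-Σ*  : ∀ x y z → InΣ* x → InΣ* y → dec x y ≡ just z → InΣ* z
    E-Σ*    : ∀ x → E x → InΣ* x
    E-nonempty : ∃ E
    extra   : Extra L enc

record Interpretation (At : Set) (L : Logic) : Set₁ where
  field
    alg  : InfonAlgebra L
    vAt  : At → Str
    vTop : Str
    vAt-Σ* : ∀ p → InΣ* (vAt p)
    vTop-E : InfonAlgebra.E alg vTop
  open InfonAlgebra alg
  ⟦_⟧ : Infon At → Str
  ⟦ top ⟧    = vTop
  ⟦ bot ⟧    = fstr
  ⟦ atom p ⟧ = vAt p
  ⟦ φ ∧ᵢ ψ ⟧ = π ⟦ φ ⟧ ⟦ ψ ⟧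
  ⟦ φ ⇒ᵢ ψ ⟧ = enc ⟦ φ ⟧ ⟦ ψ ⟧

BotClause : (L : Logic) → (Str → Str → Str) → (Str → Set) → Set
BotClause P⊥  enc M = M fstr → ∀ a → M a
BotClause P⊥w enc M = ∀ a b → M fstr → M (enc a b) → M b

IsClosed : {L : Logic} → InfonAlgebra L → (Str → Set) → Set
IsClosed {L} A M =
  (∀ x → E x → M x) ×
  (∀ a b → (M a × M b) ⇔ M (π a b)) ×
  (∀ a b → M a → M (enc a b) → M b) ×
  (∀ a b → M b → M (enc a b)) ×
  BotClause L enc M
  where open InfonAlgebra A

module _ {At : Set} {L : Logic} (I : Interpretation At L) where
  open Interpretation I

  LeastClosed : (Infon At → Set) → Str → Set₁
  LeastClosed T x = (M : Str → Set) → IsClosed alg M →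
                    (∀ φ → T φ → M ⟦ φ ⟧) → M x

  Injective-I : Set
  Injective-I = ∀ φ₁ φ₂ → ⟦ φ₁ ⟧ ≡ ⟦ φ₂ ⟧ → φ₁ ≡ φ₂

  Conservative : Set₁
  Conservative = (T : Infon At → Set) → DedClosed L T →
                 ∀ ψ → ¬ T ψ → ¬ LeastClosed T ⟦ ψ ⟧

  Plain : Set₁
  Plain = Injective-I × Conservative

-- Infons are encoded as strings over {0,1} through a self-delimiting pairing, and
-- every string parses homomorphically to an infon whose atoms are strings (strings
-- that are not codes become atoms); the parse of v(φ) is φ with its atoms renamed
-- by v, which gives injectivity. For conservativity, given a deductively closed T,
-- the strings whose parse is derivable from the renamed T form a closed set
-- containing v(T). So v(ψ) in the least closed set yields a derivation of the
-- renamed ψ, and substituting the atoms back along a partial inverse of the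
-- injective renaming, defined on the finitely many atoms of the hypotheses used,
-- gives T ⊢ ψ.
module Submission where

open import Data.List using (List; []; _∷_; _++_; length; replicate; drop)
open import Data.List.Properties using (≡-dec; length-replicate)
open import Data.List.Membership.Propositional using (_∈_)
open import Data.List.Relation.Unary.All using (All; []; _∷_; tabulate)
open import Data.List.Relation.Unary.All.Properties using (++⁻; drop⁺; replicate⁺)
open import Data.List.Relation.Unary.Any using (tail)
open import Data.Maybe using (Maybe; just; nothing)
import Data.Maybe as Maybe
open import Data.Nat using (ℕ; zero; suc; _<_; s≤s; z≤n)
open import Data.Nat.Properties using (m<n⇒m<1+n; n<1+n; <-≤-trans)
open import Data.Product using (Σ; _×_; _,_)
open import Data.Unit using (tt)
open import Function using (_∘_)
open import Function.Bundles using (mk⇔)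
open import Function.Definitions using (Injective)
import Function.Construct.Composition as Compose
open import Relation.Binary.Definitions using (DecidableEquality)
open import Relation.Binary.PropositionalEquality
  using (_≡_; refl; sym; trans; cong; cong₂; subst; module ≡-Reasoning)
open import Relation.Nullary using (yes; no)
open import Defs

open ≡-Reasoning

mapᵢ : {A B : Set} → (A → B) → Infon A → Infon B
mapᵢ g top      = top
mapᵢ g bot      = bot
mapᵢ g (atom p) = atom (g p)
mapᵢ g (φ ∧ᵢ ψ) = mapᵢ g φ ∧ᵢ mapᵢ g ψ
mapᵢ g (φ ⇒ᵢ ψ) = mapᵢ g φ ⇒ᵢ mapᵢ g ψ

bindᵢ : {A B : Set} → (A → Infon B) → Infon A → Infon B
bindᵢ σ top      = top
bindᵢ σ bot      = bot
bindᵢ σ (atom p) = σ p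
bindᵢ σ (φ ∧ᵢ ψ) = bindᵢ σ φ ∧ᵢ bindᵢ σ ψ
bindᵢ σ (φ ⇒ᵢ ψ) = bindᵢ σ φ ⇒ᵢ bindᵢ σ ψ

atoms : {A : Set} → Infon A → List A
atoms top      = []
atoms bot      = []
atoms (atom p) = p ∷ []
atoms (φ ∧ᵢ ψ) = atoms φ ++ atoms ψ
atoms (φ ⇒ᵢ ψ) = atoms φ ++ atoms ψ

module _ {A B : Set} (g : A → B) where

  LeftInverseOn : (B → Infon A) → List A → Set
  LeftInverseOn σ = All (λ p → σ (g p) ≡ atom p)

  bind-map-inverse : ∀ {σ} φ → LeftInverseOn σ (atoms φ) → bindᵢ σ (mapᵢ g φ) ≡ φ
  bind-map-inverse top      _         = refl
  bind-map-inverse bot      _         = refl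
  bind-map-inverse (atom p) (σgp ∷ []) = σgp
  bind-map-inverse (φ ∧ᵢ ψ) inv       = let invφ , invψ = ++⁻ (atoms φ) inv in
    cong₂ _∧ᵢ_ (bind-map-inverse φ invφ) (bind-map-inverse ψ invψ)
  bind-map-inverse (φ ⇒ᵢ ψ) inv       = let invφ , invψ = ++⁻ (atoms φ) inv in
    cong₂ _⇒ᵢ_ (bind-map-inverse φ invφ) (bind-map-inverse ψ invψ)

  module _ (_≟_ : DecidableEquality B) (g-injective : Injective _≡_ _≡_ g) where

    partialInverse : List A → B → Infon A
    partialInverse []       _ = top
    partialInverse (q ∷ qs) b with g q ≟ b
    ... | yes _ = atom q
    ... | no  _ = partialInverse qs b

    partialInverse-∈ : ∀ ps {p} → p ∈ ps → partialInverse ps (g p) ≡ atom p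
    partialInverse-∈ (q ∷ qs) {p} p∈ with g q ≟ g p
    ... | yes gq≡gp = cong atom (g-injective gq≡gp)
    ... | no  gq≢gp = partialInverse-∈ qs (tail (λ p≡q → gq≢gp (cong g (sym p≡q))) p∈)

    partialInverse-leftInverseOn : ∀ ps → LeftInverseOn (partialInverse ps) ps
    partialInverse-leftInverseOn ps = tabulate (partialInverse-∈ ps)

    mapᵢ-injective : Injective _≡_ _≡_ (mapᵢ g)
    mapᵢ-injective {φ} {ψ} gφ≡gψ =
      let invφ , invψ = ++⁻ (atoms φ) (partialInverse-leftInverseOn (atoms φ ++ atoms ψ)) in
      begin
        φ                  ≡⟨ sym (bind-map-inverse φ invφ) ⟩
        bindᵢ σ (mapᵢ g φ) ≡⟨ cong (bindᵢ σ) gφ≡gψ ⟩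
        bindᵢ σ (mapᵢ g ψ) ≡⟨ bind-map-inverse ψ invψ ⟩
        ψ                  ∎
      where
      σ : B → Infon A
      σ = partialInverse (atoms φ ++ atoms ψ)

imageᵢ : {A B : Set} → (A → B) → (Infon A → Set) → Infon B → Set
imageᵢ g T χ = Σ _ λ φ → T φ × mapᵢ g φ ≡ χ

module _ {A B : Set} {g : A → B} {L : Logic} (T : Infon A → Set) where

  hypothesisAtoms : ∀ {χ} → imageᵢ g T ⊢[ L ] χ → List A
  hypothesisAtoms (hyp (φ , _ , _)) = atoms φ
  hypothesisAtoms topI              = []
  hypothesisAtoms (∧I d e)          = hypothesisAtoms d ++ hypothesisAtoms e
  hypothesisAtoms (∧E₁ d)           = hypothesisAtoms d
  hypothesisAtoms (∧E₂ d)           = hypothesisAtoms d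
  hypothesisAtoms (⇒I d)            = hypothesisAtoms d
  hypothesisAtoms (⇒E d e)          = hypothesisAtoms d ++ hypothesisAtoms e
  hypothesisAtoms (⊥E d)            = hypothesisAtoms d
  hypothesisAtoms (⊥wE d e)         = hypothesisAtoms d ++ hypothesisAtoms e

  ⊢-bind : ∀ σ {χ} (d : imageᵢ g T ⊢[ L ] χ) → LeftInverseOn g σ (hypothesisAtoms d) →
           T ⊢[ L ] bindᵢ σ χ
  ⊢-bind σ (hyp (φ , Tφ , refl)) inv = hyp (subst T (sym (bind-map-inverse g φ inv)) Tφ)
  ⊢-bind σ topI                  _   = topI
  ⊢-bind σ (∧I d e)              inv = let invd , inve = ++⁻ (hypothesisAtoms d) inv in
    ∧I (⊢-bind σ d invd) (⊢-bind σ e inve)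
  ⊢-bind σ (∧E₁ d)               inv = ∧E₁ (⊢-bind σ d inv)
  ⊢-bind σ (∧E₂ d)               inv = ∧E₂ (⊢-bind σ d inv)
  ⊢-bind σ (⇒I d)                inv = ⇒I (⊢-bind σ d inv)
  ⊢-bind σ (⇒E d e)              inv = let invd , inve = ++⁻ (hypothesisAtoms d) inv in
    ⇒E (⊢-bind σ d invd) (⊢-bind σ e inve)
  ⊢-bind σ (⊥E d)                inv = ⊥E (⊢-bind σ d inv)
  ⊢-bind σ (⊥wE d e)             inv = let invd , inve = ++⁻ (hypothesisAtoms d) inv in
    ⊥wE (⊢-bind σ d invd) (⊢-bind σ e inve)

  ⊢-mapᵢ-reflect : DecidableEquality B → Injective _≡_ _≡_ g →
                   ∀ {ψ} → imageᵢ g T ⊢[ L ] mapᵢ g ψ → T ⊢[ L ] ψ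
  ⊢-mapᵢ-reflect _≟_ g-injective {ψ} d =
    let invd , invψ = ++⁻ (hypothesisAtoms d)
                          (partialInverse-leftInverseOn g _≟_ g-injective used) in
    subst (T ⊢[ L ]_) (bind-map-inverse g ψ invψ) (⊢-bind σ d invd)
    where
    used : List A
    used = hypothesisAtoms d ++ atoms ψ
    σ : B → Infon A
    σ = partialInverse g _≟_ g-injective used

_≟ˢ_ : DecidableEquality Sym
b0 ≟ˢ b0 = yes refl
b0 ≟ˢ b1 = no λ ()
b0 ≟ˢ 𝕗  = no λ ()
b1 ≟ˢ b0 = no λ ()
b1 ≟ˢ b1 = yes refl
b1 ≟ˢ 𝕗  = no λ ()
𝕗  ≟ˢ b0 = no λ ()
𝕗  ≟ˢ b1 = no λ ()
𝕗  ≟ˢ 𝕗  = yes refl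

_≟*_ : DecidableEquality Str
_≟*_ = ≡-dec _≟ˢ_

⟪_,_⟫ : Str → Str → Str
⟪ []    , b ⟫ = b0 ∷ b
⟪ s ∷ a , b ⟫ = b1 ∷ s ∷ ⟪ a , b ⟫

⟪⟫-Σ* : ∀ {a b} → InΣ* a → InΣ* b → InΣ* ⟪ a , b ⟫
⟪⟫-Σ* []         b∈Σ* = (λ ()) ∷ b∈Σ*
⟪⟫-Σ* (s∉ ∷ a∈Σ*) b∈Σ* = (λ ()) ∷ s∉ ∷ ⟪⟫-Σ* a∈Σ* b∈Σ*

⟪⟫-lengthˡ : ∀ a b → length a < length ⟪ a , b ⟫
⟪⟫-lengthˡ []      b = s≤s z≤n
⟪⟫-lengthˡ (s ∷ a) b = s≤s (m<n⇒m<1+n (⟪⟫-lengthˡ a b))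

⟪⟫-lengthʳ : ∀ a b → length b < length ⟪ a , b ⟫
⟪⟫-lengthʳ []      b = n<1+n (length b)
⟪⟫-lengthʳ (s ∷ a) b = m<n⇒m<1+n (m<n⇒m<1+n (⟪⟫-lengthʳ a b))

unpairˡ : Str → Str
unpairˡ (b1 ∷ s ∷ r) = s ∷ unpairˡ r
unpairˡ _            = []

unpairʳ : Str → Str
unpairʳ (b0 ∷ r)     = r
unpairʳ (b1 ∷ _ ∷ r) = unpairʳ r
unpairʳ _            = []

unpairˡ-⟪⟫ : ∀ a b → unpairˡ ⟪ a , b ⟫ ≡ a
unpairˡ-⟪⟫ []      b = refl
unpairˡ-⟪⟫ (s ∷ a) b = cong (s ∷_) (unpairˡ-⟪⟫ a b)

unpairʳ-⟪⟫ : ∀ a b → unpairʳ ⟪ a , b ⟫ ≡ b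
unpairʳ-⟪⟫ []      b = refl
unpairʳ-⟪⟫ (s ∷ a) b = unpairʳ-⟪⟫ a b

unpairˡ-Σ* : ∀ x → InΣ* x → InΣ* (unpairˡ x)
unpairˡ-Σ* []           _                 = []
unpairˡ-Σ* (b0 ∷ _)     _                 = []
unpairˡ-Σ* (𝕗 ∷ _)      _                 = []
unpairˡ-Σ* (b1 ∷ [])    _                 = []
unpairˡ-Σ* (b1 ∷ s ∷ r) (_ ∷ s∉ ∷ r∈Σ*) = s∉ ∷ unpairˡ-Σ* r r∈Σ*

unpairʳ-Σ* : ∀ x → InΣ* x → InΣ* (unpairʳ x)
unpairʳ-Σ* []           _                = []
unpairʳ-Σ* (b0 ∷ r)     (_ ∷ r∈Σ*)      = r∈Σ*
unpairʳ-Σ* (𝕗 ∷ _)      _                = []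
unpairʳ-Σ* (b1 ∷ [])    _                = []
unpairʳ-Σ* (b1 ∷ _ ∷ r) (_ ∷ _ ∷ r∈Σ*) = unpairʳ-Σ* r r∈Σ*

data Pairing : Str → Set where
  pair : ∀ a b → Pairing ⟪ a , b ⟫

pair-cons : ∀ {r} s → Pairing r → Pairing (b1 ∷ s ∷ r)
pair-cons s (pair a b) = pair (s ∷ a) b

unpair : (r : Str) → Maybe (Pairing r)
unpair (b0 ∷ b)     = just (pair [] b)
unpair (b1 ∷ s ∷ r) = Maybe.map (pair-cons s) (unpair r)
unpair _            = nothing

unpair-⟪⟫ : ∀ a b → unpair ⟪ a , b ⟫ ≡ just (pair a b)
unpair-⟪⟫ []      b = refl
unpair-⟪⟫ (s ∷ a) b = cong (Maybe.map (pair-cons s)) (unpair-⟪⟫ a b)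

πˢ encˢ : Str → Str → Str
πˢ   a b = b0 ∷ ⟪ a , b ⟫
encˢ a b = b1 ∷ b0 ∷ ⟪ a , b ⟫

lˢ rˢ : Str → Maybe Str
lˢ x = just (unpairˡ (drop 1 x))
rˢ x = just (unpairʳ (drop 1 x))

decˢ : Str → Str → Maybe Str
decˢ _ y = just (unpairʳ (drop 2 y))

decˢ-encˢ : ∀ a b → decˢ a (encˢ a b) ≡ just b
decˢ-encˢ a b = cong just (unpairʳ-⟪⟫ a b)

stringExtra : ∀ L → Extra L encˢ
stringExtra P⊥  = tt
stringExtra P⊥w = decˢ , decˢ-encˢ

stringAlgebra : ∀ L → InfonAlgebra L
stringAlgebra L = record
  { π          = πˢ
  ; enc        = encˢ
  ; l          = lˢ
  ; r          = rˢ
  ; dec        = decˢ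
  ; E          = _≡ []
  ; l-π        = λ a b → cong just (unpairˡ-⟪⟫ a b)
  ; r-π        = λ a b → cong just (unpairʳ-⟪⟫ a b)
  ; dec-enc    = decˢ-encˢ
  ; π-Σ*       = λ _ _ a∈Σ* b∈Σ* → (λ ()) ∷ ⟪⟫-Σ* a∈Σ* b∈Σ*
  ; enc-Σ*     = λ _ _ a∈Σ* b∈Σ* → (λ ()) ∷ (λ ()) ∷ ⟪⟫-Σ* a∈Σ* b∈Σ*
  ; l-Σ*       = λ { x _ x∈Σ* refl → unpairˡ-Σ* _ (drop⁺ 1 x∈Σ*) }
  ; r-Σ*       = λ { x _ x∈Σ* refl → unpairʳ-Σ* _ (drop⁺ 1 x∈Σ*) }
  ; dec-Σ*     = λ { _ _ _ _ y∈Σ* refl → unpairʳ-Σ* _ (drop⁺ 2 y∈Σ*) }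
  ; E-Σ*       = λ { _ refl → [] }
  ; E-nonempty = [] , refl
  ; extra      = stringExtra L
  }

data Shape : Str → Set where
  top-shape  : Shape []
  bot-shape  : Shape fstr
  ∧-shape    : ∀ a b → Shape (πˢ a b)
  ⇒-shape    : ∀ a b → Shape (encˢ a b)
  atom-shape : ∀ x → Shape x

∧-shape? : ∀ {r} → Maybe (Pairing r) → Shape (b0 ∷ r)
∧-shape? (just (pair a b)) = ∧-shape a b
∧-shape? nothing           = atom-shape _

⇒-shape? : ∀ {r} → Maybe (Pairing r) → Shape (b1 ∷ b0 ∷ r)
⇒-shape? (just (pair a b)) = ⇒-shape a b
⇒-shape? nothing           = atom-shape _

shape : ∀ x → Shape x
shape []            = top-shape
shape (𝕗 ∷ [])      = bot-shape
shape (b0 ∷ r)      = ∧-shape? (unpair r)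
shape (b1 ∷ b0 ∷ r) = ⇒-shape? (unpair r)
shape x             = atom-shape x

shape-πˢ : ∀ a b → shape (πˢ a b) ≡ ∧-shape a b
shape-πˢ a b = cong ∧-shape? (unpair-⟪⟫ a b)

shape-encˢ : ∀ a b → shape (encˢ a b) ≡ ⇒-shape a b
shape-encˢ a b = cong ⇒-shape? (unpair-⟪⟫ a b)

readShape : (Str → Infon Str) → ∀ {x} → Shape x → Infon Str
readShape read top-shape      = top
readShape read bot-shape      = bot
readShape read (∧-shape a b)  = read a ∧ᵢ read b
readShape read (⇒-shape a b)  = read a ⇒ᵢ read b
readShape read (atom-shape x) = atom x

readShape-cong : ∀ {f h x} (s : Shape x) → (∀ {y} → length y < length x → f y ≡ h y) →
                 readShape f s ≡ readShape h s
readShape-cong top-shape      _   = refl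
readShape-cong bot-shape      _   = refl
readShape-cong (∧-shape a b)  f≗h =
  cong₂ _∧ᵢ_ (f≗h (m<n⇒m<1+n (⟪⟫-lengthˡ a b))) (f≗h (m<n⇒m<1+n (⟪⟫-lengthʳ a b)))
readShape-cong (⇒-shape a b)  f≗h =
  cong₂ _⇒ᵢ_ (f≗h (m<n⇒m<1+n (m<n⇒m<1+n (⟪⟫-lengthˡ a b))))
             (f≗h (m<n⇒m<1+n (m<n⇒m<1+n (⟪⟫-lengthʳ a b))))
readShape-cong (atom-shape x) _   = refl

-- The junk value at zero fuel is never reached when the fuel exceeds the length
-- (parseWith-fuel), since the components of a pair are strictly shorter.
parseWith : ℕ → Str → Infon Str
parseWith zero    x = atom x
parseWith (suc n) x = readShape (parseWith n) (shape x)

parse : Str → Infon Str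
parse x = parseWith (suc (length x)) x

parseWith-fuel : ∀ {m n} x → length x < m → length x < n → parseWith m x ≡ parseWith n x
parseWith-fuel {suc m} {suc n} x (s≤s x≤m) (s≤s x≤n) = readShape-cong (shape x) λ y<x →
  parseWith-fuel _ (<-≤-trans y<x x≤m) (<-≤-trans y<x x≤n)

parse-unfold : ∀ x → parse x ≡ readShape parse (shape x)
parse-unfold x = readShape-cong (shape x) λ {y} y<x → parseWith-fuel y y<x (n<1+n (length y))

parse-πˢ : ∀ a b → parse (πˢ a b) ≡ parse a ∧ᵢ parse b
parse-πˢ a b = trans (parse-unfold (πˢ a b)) (cong (readShape parse) (shape-πˢ a b))

parse-encˢ : ∀ a b → parse (encˢ a b) ≡ parse a ⇒ᵢ parse b
parse-encˢ a b = trans (parse-unfold (encˢ a b)) (cong (readShape parse) (shape-encˢ a b))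

module _ (Γ : Infon Str → Set) where

  ParsesDerivable : Logic → Str → Set
  ParsesDerivable L x = Γ ⊢[ L ] parse x

  parsesDerivable-botClause : ∀ L → BotClause L encˢ (ParsesDerivable L)
  parsesDerivable-botClause P⊥  ⊢bot a       = ⊥E ⊢bot
  parsesDerivable-botClause P⊥w a b ⊢bot ⊢ab =
    ⊥wE ⊢bot (subst (Γ ⊢[ P⊥w ]_) (parse-encˢ a b) ⊢ab)

  parsesDerivable-closed : ∀ L → IsClosed (stringAlgebra L) (ParsesDerivable L)
  parsesDerivable-closed L =
      (λ { _ refl → topI })
    , (λ a b → mk⇔ (λ (⊢a , ⊢b) → from-π a b (∧I ⊢a ⊢b))
                   (λ ⊢ab → ∧E₁ (to-π a b ⊢ab) , ∧E₂ (to-π a b ⊢ab)))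
    , (λ a b ⊢a ⊢ab → ⇒E ⊢a (to-enc a b ⊢ab))
    , (λ a b ⊢b → from-enc a b (⇒I ⊢b))
    , parsesDerivable-botClause L
    where
    to-π : ∀ a b → ParsesDerivable L (πˢ a b) → Γ ⊢[ L ] (parse a ∧ᵢ parse b)
    to-π a b = subst (Γ ⊢[ L ]_) (parse-πˢ a b)
    from-π : ∀ a b → Γ ⊢[ L ] (parse a ∧ᵢ parse b) → ParsesDerivable L (πˢ a b)
    from-π a b = subst (Γ ⊢[ L ]_) (sym (parse-πˢ a b))
    to-enc : ∀ a b → ParsesDerivable L (encˢ a b) → Γ ⊢[ L ] (parse a ⇒ᵢ parse b)
    to-enc a b = subst (Γ ⊢[ L ]_) (parse-encˢ a b)
    from-enc : ∀ a b → Γ ⊢[ L ] (parse a ⇒ᵢ parse b) → ParsesDerivable L (encˢ a b)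
    from-enc a b = subst (Γ ⊢[ L ]_) (sym (parse-encˢ a b))

atomˢ : ℕ → Str
atomˢ n = b1 ∷ b1 ∷ replicate n b0

atomˢ-Σ* : ∀ n → InΣ* (atomˢ n)
atomˢ-Σ* n = (λ ()) ∷ (λ ()) ∷ replicate⁺ n (λ ())

atomˢ-injective : Injective _≡_ _≡_ atomˢ
atomˢ-injective {m} {n} eq = begin
  m                                ≡⟨ sym (length-replicate m) ⟩
  length (drop 2 (atomˢ m))        ≡⟨ cong (length ∘ drop 2) eq ⟩
  length (drop 2 (atomˢ n))        ≡⟨ length-replicate n ⟩
  n                                ∎

module _ {At : Set} (code : At → ℕ) where

  stringInterpretation : ∀ L → Interpretation At L
  stringInterpretation L = record
    { alg    = stringAlgebra L
    ; vAt    = atomˢ ∘ code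
    ; vTop   = []
    ; vAt-Σ* = atomˢ-Σ* ∘ code
    ; vTop-E = refl
    }

  module _ {L : Logic} where
    open Interpretation (stringInterpretation L)

    parse-⟦⟧ : ∀ φ → parse ⟦ φ ⟧ ≡ mapᵢ (atomˢ ∘ code) φ
    parse-⟦⟧ top      = refl
    parse-⟦⟧ bot      = refl
    parse-⟦⟧ (atom p) = refl
    parse-⟦⟧ (φ ∧ᵢ ψ) = trans (parse-πˢ ⟦ φ ⟧ ⟦ ψ ⟧) (cong₂ _∧ᵢ_ (parse-⟦⟧ φ) (parse-⟦⟧ ψ))
    parse-⟦⟧ (φ ⇒ᵢ ψ) = trans (parse-encˢ ⟦ φ ⟧ ⟦ ψ ⟧) (cong₂ _⇒ᵢ_ (parse-⟦⟧ φ) (parse-⟦⟧ ψ))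

    module _ (code-injective : Injective _≡_ _≡_ code) where

      vAt-injective : Injective _≡_ _≡_ (atomˢ ∘ code)
      vAt-injective = Compose.injective _≡_ _≡_ _≡_ code-injective atomˢ-injective

      stringInterpretation-injective : Injective-I (stringInterpretation L)
      stringInterpretation-injective φ₁ φ₂ eq =
        mapᵢ-injective (atomˢ ∘ code) _≟*_ vAt-injective (begin
          mapᵢ (atomˢ ∘ code) φ₁ ≡⟨ sym (parse-⟦⟧ φ₁) ⟩
          parse ⟦ φ₁ ⟧           ≡⟨ cong parse eq ⟩
          parse ⟦ φ₂ ⟧           ≡⟨ parse-⟦⟧ φ₂ ⟩
          mapᵢ (atomˢ ∘ code) φ₂ ∎)

      stringInterpretation-conservative : Conservative (stringInterpretation L)
      stringInterpretation-conservative T T-closed ψ ψ∉T ⟦ψ⟧∈least =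
        ψ∉T (T-closed ψ (⊢-mapᵢ-reflect T _≟*_ vAt-injective ⊢ψ))
        where
        Γ : Infon Str → Set
        Γ = imageᵢ (atomˢ ∘ code) T
        hyp-⟦⟧ : ∀ φ → T φ → ParsesDerivable Γ L ⟦ φ ⟧
        hyp-⟦⟧ φ Tφ = subst (Γ ⊢[ L ]_) (sym (parse-⟦⟧ φ)) (hyp (φ , Tφ , refl))
        ⊢ψ : Γ ⊢[ L ] mapᵢ (atomˢ ∘ code) ψ
        ⊢ψ = subst (Γ ⊢[ L ]_) (parse-⟦⟧ ψ)
               (⟦ψ⟧∈least (ParsesDerivable Γ L) (parsesDerivable-closed Γ L) hyp-⟦⟧)

lemma3 : (At : Set) (code : At → ℕ) → Injective _≡_ _≡_ code →
         Σ (Interpretation At P⊥) Plain × Σ (Interpretation At P⊥w) Plain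
lemma3 At code code-injective =
    (stringInterpretation code P⊥  , plain)
  , (stringInterpretation code P⊥w , plain)
  where
  plain : ∀ {L} → Plain (stringInterpretation code L)
  plain = stringInterpretation-injective code code-injective
        , stringInterpretation-conservative code code-injective
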